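{- Let $m\ge 0$ be an integer. Then $E_{m,n}(x)=0$ for $n=0,1,\dots,m-1$, and for every integer $n\ge 0$, $$E_{m,n+m}(x)=2\binom{n+m}{n}x^n-\sum_{j=0}^n\binom{n+m}{j}E_{m,j}(x).$$
   Context: For a non-negative integer $m$, the truncated Euler polynomials $E_{m,n}(x)$ are defined by the generating function $$\frac{\frac{2t^m}{m!}e^{xt}}{e^t+1-\sum_{j=0}^{m-1}\frac{t^j}{j!}}=\sum_{n=0}^\infty E_{m,n}(x)\frac{t^n}{n!}.$$ -}

module Defs where

open import Data.Nat as ℕ using (ℕ; zero; suc; _∸_; _<ᵇ_; _≤ᵇ_; _!)
open import Data.Nat.Combinatorics using (_C_)
open import Data.Integer using (+_)
open import Data.Rational using (ℚ; 0ℚ; 1ℚ; _+_; _*_; _-_; _/_; 1/_; ≢-nonZero)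
open import Data.Rational.Properties using (_≟_)
open import Data.Bool using (if_then_else_)
open import Relation.Nullary using (yes; no)

ℕ→ℚ : ℕ → ℚ
ℕ→ℚ n = + n / 1

_^ℚ_ : ℚ → ℕ → ℚ
x ^ℚ zero  = 1ℚ
x ^ℚ suc n = x * (x ^ℚ n)

-- multiplicative inverse, with the (irrelevant here) convention 1/0 = 0
inv : ℚ → ℚ
inv p with p ≟ 0ℚ
... | yes _  = 0ℚ
... | no p≢0 = 1/_ p {{≢-nonZero p≢0}}

sumTo : ℕ → (ℕ → ℚ) → ℚ
sumTo zero    f = f 0
sumTo (suc n) f = sumTo n f + f (suc n)

-- formal power series over ℚ in t, as coefficient sequences
Series : Set
Series = ℕ → ℚ

_⊛_ : Series → Series → Series
(f ⊛ g) n = sumTo n (λ i → f i * g (n ∸ i))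

-- quotient f / g of power series (g 0 ≠ 0): coefficients q_n determined by
-- (g ⊛ q) = f, i.e. q_n = (f_n - Σ_{k=1}^{n} g_k q_{n-k}) / g_0.
-- prefix n j = q_j for j ≤ n.
private
  prefix : Series → Series → ℕ → ℕ → ℚ
  prefix f g zero    _ = f 0 * inv (g 0)
  prefix f g (suc n) j =
    if j ℕ.≤ᵇ n then prefix f g n j
    else (f (suc n) - sumTo n (λ i → g (suc i) * prefix f g n (n ∸ i))) * inv (g 0)

_⊘_ : Series → Series → Series
(f ⊘ g) n = prefix f g n n

expS : ℚ → Series
expS a n = (a ^ℚ n) * inv (ℕ→ℚ (n !))

mono : ℚ → ℕ → Series
mono c m n = if n ℕ.≡ᵇ m then c else 0ℚ

truncExp : ℕ → Series
truncExp m n = if n <ᵇ m then inv (ℕ→ℚ (n !)) else 0ℚ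

numer : ℕ → ℚ → Series
numer m x = mono (ℕ→ℚ 2 * inv (ℕ→ℚ (m !))) m ⊛ expS x

denom : ℕ → Series
denom m n = expS 1ℚ n + mono 1ℚ 0 n - truncExp m n

E : ℕ → ℕ → ℚ → ℚ
E m n x = ℕ→ℚ (n !) * (numer m x ⊘ denom m) n

-- Write q for the quotient series, so that E_{m,n}(x) = n! q_n. The denominator is 1 + T
-- with T = Σ_{i ≥ m} t^i / i!, so comparing coefficients of t^N in (1 + T) q = (2 t^m / m!) e^{x t}
-- gives q_N + Σ_{k ≤ N - m} q_{N-m-k} / (k+m)! = [t^N] numerator. For N < m the sum is empty and
-- the right side vanishes, so q_N = 0. For N = n + m, multiplying by (n+m)! turns each
-- (n+m)! / (k+m)! · q_{n-k} into C(n+m, n-k) E_{m,n-k} and the right side into 2 C(n+m, n) x^n.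
module Submission where

open import Defs
open import Data.Nat using (ℕ; _+_; _<_)
open import Data.Nat.Combinatorics using (_C_)
open import Data.Rational using (ℚ; 0ℚ) renaming (_*_ to _*ℚ_; _-_ to _-ℚ_)
open import Data.Product using (_×_)
open import Relation.Binary.PropositionalEquality using (_≡_)

open import Data.Nat as ℕ using (zero; suc; _∸_; _≤_; z≤n; s≤s; _≤ᵇ_; _<ᵇ_; _!)
import Data.Nat.Properties as ℕP
import Data.Nat.Combinatorics as ℕC
import Data.Nat.DivMod as ℕD
import Data.Nat.Coprimality as Coprimality
import Data.Integer as ℤ
import Data.Integer.Properties as ℤP
open import Data.Bool using (true; false; T; if_then_else_)
open import Data.Rational using (1ℚ; _*_; _-_; _/_; mkℚ; ≢-nonZero) renaming (_+_ to _+ℚ_)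
import Data.Rational.Properties as ℚP
open import Data.Product using (_,_)
open import Data.Empty using (⊥-elim)
open import Function using (case_of_)
open import Relation.Nullary using (¬_; yes; no; contradiction)
open import Relation.Binary.PropositionalEquality
  using (refl; sym; trans; cong; cong₂; module ≡-Reasoning)
open import Algebra.Solver.Ring.AlmostCommutativeRing using (fromCommutativeRing)
open import Algebra.Solver.Ring.Simple (fromCommutativeRing ℚP.+-*-commutativeRing) ℚP._≟_

open ≡-Reasoning

if-T : ∀ {A : Set} {b} {x y : A} → T b → (if b then x else y) ≡ x
if-T {b = true} _ = refl

if-¬T : ∀ {A : Set} {b} {x y : A} → ¬ T b → (if b then x else y) ≡ y
if-¬T {b = false} _ = refl
if-¬T {b = true}  ¬t = contradiction _ ¬t

≥⇒¬<ᵇ : ∀ {i m} → m ≤ i → ¬ T (i <ᵇ m)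
≥⇒¬<ᵇ {i} {m} m≤i t = ℕP.<⇒≱ (ℕP.<ᵇ⇒< i m t) m≤i

+-∸-+ : ∀ n k m → (n + m) ∸ (k + m) ≡ n ∸ k
+-∸-+ n k m = trans (cong₂ _∸_ (ℕP.+-comm n m) (ℕP.+-comm k m)) (ℕP.[m+n]∸[m+o]≡n∸o m n k)

n!≡nCk*[k!*[n∸k]!] : ∀ n k → k ≤ n → n ! ≡ (n C k) ℕ.* (k ! ℕ.* (n ∸ k) !)
n!≡nCk*[k!*[n∸k]!] n k k≤n = sym (begin
  (n C k) ℕ.* (k ! ℕ.* (n ∸ k) !)
    ≡⟨ cong (ℕ._* (k ! ℕ.* (n ∸ k) !)) (ℕC.nCk≡n!/k![n-k]! k≤n) ⟩
  (n ! ℕD./ (k ! ℕ.* (n ∸ k) !)) ℕ.* (k ! ℕ.* (n ∸ k) !)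
    ≡⟨ ℕD.m/n*n≡m (ℕC.k![n∸k]!∣n! k≤n) ⟩
  n ! ∎)
  where instance _ = k ℕP.!* (n ∸ k) !≢0

*-invʳ : ∀ p → ¬ p ≡ 0ℚ → p * inv p ≡ 1ℚ
*-invʳ p ¬p≡0 with p ℚP.≟ 0ℚ
... | yes p≡0 = ⊥-elim (¬p≡0 p≡0)
... | no  p≢0 = ℚP.*-inverseʳ p {{≢-nonZero p≢0}}

ℕ→ℚ-mkℚ : ∀ n → ℕ→ℚ n ≡ mkℚ (ℤ.+ n) 0 (Coprimality.sym (Coprimality.1-coprimeTo n))
ℕ→ℚ-mkℚ n = ℚP.normalize-coprime (Coprimality.sym (Coprimality.1-coprimeTo n))

ℕ→ℚ-* : ∀ a b → ℕ→ℚ (a ℕ.* b) ≡ ℕ→ℚ a * ℕ→ℚ b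
ℕ→ℚ-* a b = sym (trans (cong₂ _*_ (ℕ→ℚ-mkℚ a) (ℕ→ℚ-mkℚ b)) (cong (_/ 1) (sym (ℤP.pos-* a b))))

ℕ→ℚ-!≢0 : ∀ n → ¬ ℕ→ℚ (n !) ≡ 0ℚ
ℕ→ℚ-!≢0 n with n ! | ℕP._!≢0 n
... | suc k | _ = λ k+1≡0 → case trans (sym (ℕ→ℚ-mkℚ (suc k))) k+1≡0 of λ ()

n!/[n∸k]!≡nCk*k! : ∀ n k → k ≤ n → ℕ→ℚ (n !) * inv (ℕ→ℚ ((n ∸ k) !)) ≡ ℕ→ℚ (n C k) * ℕ→ℚ (k !)
n!/[n∸k]!≡nCk*k! n k k≤n = begin
  ℕ→ℚ (n !) * inv K
    ≡⟨ cong (λ z → z * inv K) n!≡ ⟩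
  B * (J * K) * inv K
    ≡⟨ solve 4 (λ B J K iK → B :* (J :* K) :* iK := B :* J :* (K :* iK)) refl B J K (inv K) ⟩
  B * J * (K * inv K)
    ≡⟨ cong (B * J *_) (*-invʳ K (ℕ→ℚ-!≢0 (n ∸ k))) ⟩
  B * J * 1ℚ
    ≡⟨ ℚP.*-identityʳ (B * J) ⟩
  B * J ∎
  where
  B = ℕ→ℚ (n C k)
  J = ℕ→ℚ (k !)
  K = ℕ→ℚ ((n ∸ k) !)
  n!≡ : ℕ→ℚ (n !) ≡ B * (J * K)
  n!≡ = trans (cong ℕ→ℚ (n!≡nCk*[k!*[n∸k]!] n k k≤n))
              (trans (ℕ→ℚ-* (n C k) (k ! ℕ.* (n ∸ k) !)) (cong (B *_) (ℕ→ℚ-* (k !) ((n ∸ k) !))))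

1ℚ^ℚn≡1ℚ : ∀ n → 1ℚ ^ℚ n ≡ 1ℚ
1ℚ^ℚn≡1ℚ zero    = refl
1ℚ^ℚn≡1ℚ (suc n) = trans (ℚP.*-identityˡ (1ℚ ^ℚ n)) (1ℚ^ℚn≡1ℚ n)

VanishesBelow : ℕ → Series → Set
VanishesBelow m g = ∀ i → i < m → g i ≡ 0ℚ

sumTo-cong : ∀ n {h k : ℕ → ℚ} → (∀ i → i ≤ n → h i ≡ k i) → sumTo n h ≡ sumTo n k
sumTo-cong zero    eq = eq 0 z≤n
sumTo-cong (suc n) eq =
  cong₂ _+ℚ_ (sumTo-cong n (λ i i≤n → eq i (ℕP.m≤n⇒m≤1+n i≤n))) (eq (suc n) ℕP.≤-refl)

sumTo-zero : ∀ n (h : ℕ → ℚ) → (∀ i → i ≤ n → h i ≡ 0ℚ) → sumTo n h ≡ 0ℚ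
sumTo-zero n h h≡0 = trans (sumTo-cong n h≡0) (sumTo-0 n)
  where
  sumTo-0 : ∀ n → sumTo n (λ _ → 0ℚ) ≡ 0ℚ
  sumTo-0 zero    = refl
  sumTo-0 (suc n) = cong (_+ℚ 0ℚ) (sumTo-0 n)

sumTo-suc-head : ∀ n (h : ℕ → ℚ) → sumTo (suc n) h ≡ h 0 +ℚ sumTo n (λ i → h (suc i))
sumTo-suc-head zero    h = refl
sumTo-suc-head (suc n) h =
  trans (cong (_+ℚ h (suc (suc n))) (sumTo-suc-head n h))
        (ℚP.+-assoc (h 0) (sumTo n (λ i → h (suc i))) (h (suc (suc n))))

sumTo-head : ∀ n (h : ℕ → ℚ) → (∀ i → h (suc i) ≡ 0ℚ) → sumTo n h ≡ h 0
sumTo-head zero    h _    = refl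
sumTo-head (suc n) h tail = trans (cong₂ _+ℚ_ (sumTo-head n h tail) (tail n)) (ℚP.+-identityʳ (h 0))

sumTo-distrib-+ : ∀ n (h k : ℕ → ℚ) → sumTo n (λ i → h i +ℚ k i) ≡ sumTo n h +ℚ sumTo n k
sumTo-distrib-+ zero    h k = refl
sumTo-distrib-+ (suc n) h k =
  trans (cong (_+ℚ (h (suc n) +ℚ k (suc n))) (sumTo-distrib-+ n h k))
        (solve 4 (λ a b c d → (a :+ b) :+ (c :+ d) := (a :+ c) :+ (b :+ d)) refl
               (sumTo n h) (sumTo n k) (h (suc n)) (k (suc n)))

*-distribˡ-sumTo : ∀ n a (h : ℕ → ℚ) → a * sumTo n h ≡ sumTo n (λ i → a * h i)
*-distribˡ-sumTo zero    a h = refl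
*-distribˡ-sumTo (suc n) a h =
  trans (ℚP.*-distribˡ-+ a (sumTo n h) (h (suc n))) (cong (_+ℚ a * h (suc n)) (*-distribˡ-sumTo n a h))

sumTo-reverse : ∀ n (h : ℕ → ℚ) → sumTo n h ≡ sumTo n (λ j → h (n ∸ j))
sumTo-reverse zero    h = refl
sumTo-reverse (suc n) h =
  trans (cong (_+ℚ h (suc n)) (sumTo-reverse n h))
        (trans (ℚP.+-comm (sumTo n (λ j → h (n ∸ j))) (h (suc n)))
               (sym (sumTo-suc-head n (λ j → h (suc n ∸ j)))))

sumTo-drop : ∀ n m (h : ℕ → ℚ) → VanishesBelow m h →
             sumTo (n + m) h ≡ sumTo n (λ k → h (k + m))
sumTo-drop zero    zero    h _   = refl
sumTo-drop zero    (suc m) h h≡0 =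
  trans (cong (_+ℚ h (suc m)) (sumTo-zero m h (λ i i≤m → h≡0 i (s≤s i≤m)))) (ℚP.+-identityˡ (h (suc m)))
sumTo-drop (suc n) m       h h≡0 = cong (_+ℚ h (suc (n + m))) (sumTo-drop n m h h≡0)

⊛-vanishes-below : ∀ {m} (g h : Series) → VanishesBelow m g → VanishesBelow m (g ⊛ h)
⊛-vanishes-below {m} g h g≡0 N N<m =
  sumTo-zero N _ (λ i i≤N → trans (cong (_* h (N ∸ i)) (g≡0 i (ℕP.≤-<-trans i≤N N<m))) (ℚP.*-zeroˡ (h (N ∸ i))))

⊛-shift : ∀ {m} (g h : Series) → VanishesBelow m g →
          ∀ n → (g ⊛ h) (n + m) ≡ sumTo n (λ k → g (k + m) * h (n ∸ k))
⊛-shift {m} g h g≡0 n = begin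
  sumTo (n + m) (λ i → g i * h ((n + m) ∸ i))
    ≡⟨ sumTo-drop n m _ (λ i i<m → trans (cong (_* h ((n + m) ∸ i)) (g≡0 i i<m)) (ℚP.*-zeroˡ (h ((n + m) ∸ i)))) ⟩
  sumTo n (λ k → g (k + m) * h ((n + m) ∸ (k + m)))
    ≡⟨ sumTo-cong n (λ k _ → cong (λ d → g (k + m) * h d) (+-∸-+ n k m)) ⟩
  sumTo n (λ k → g (k + m) * h (n ∸ k)) ∎

⊛-distribʳ-+ : ∀ (g₁ g₂ h : Series) N → ((λ i → g₁ i +ℚ g₂ i) ⊛ h) N ≡ (g₁ ⊛ h) N +ℚ (g₂ ⊛ h) N
⊛-distribʳ-+ g₁ g₂ h N =
  trans (sumTo-cong N (λ i _ → ℚP.*-distribʳ-+ (h (N ∸ i)) (g₁ i) (g₂ i))) (sumTo-distrib-+ N _ _)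

mono-≢ : ∀ c m i → ¬ i ≡ m → mono c m i ≡ 0ℚ
mono-≢ c m i i≢m = if-¬T (λ t → i≢m (ℕP.≡ᵇ⇒≡ i m t))

mono-≡ : ∀ c m → mono c m m ≡ c
mono-≡ c m = if-T (ℕP.≡⇒≡ᵇ m m refl)

mono-⊛ : ∀ c m (h : Series) n → (mono c m ⊛ h) (n + m) ≡ c * h n
mono-⊛ c m h n = begin
  (mono c m ⊛ h) (n + m)
    ≡⟨ ⊛-shift (mono c m) h (λ i i<m → mono-≢ c m i (ℕP.<⇒≢ i<m)) n ⟩
  sumTo n (λ k → mono c m (k + m) * h (n ∸ k))
    ≡⟨ sumTo-head n _ (λ k → trans (cong (_* h (n ∸ suc k)) (mono-≢ c m (suc k + m) (λ e → ℕP.m≢1+n+m m (sym e))))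
                                   (ℚP.*-zeroˡ (h (n ∸ suc k)))) ⟩
  mono c m m * h n
    ≡⟨ cong (_* h n) (mono-≡ c m) ⟩
  c * h n ∎

⊛-identityˡ : ∀ (h : Series) N → (mono 1ℚ 0 ⊛ h) N ≡ h N
⊛-identityˡ h N = trans (cong (mono 1ℚ 0 ⊛ h) (sym (ℕP.+-identityʳ N)))
                        (trans (mono-⊛ 1ℚ 0 h N) (ℚP.*-identityˡ (h N)))

-- The table of partial quotients behind _⊘_ is private to Defs, so we argue about any table
-- obeying its defining clause (`row n i` is its entry at (n, n ∸ i), `beyond n` the unused one
-- at (n, n + 1)) and let unification find the actual table in ⊘-suc.
module QuotientRows (f g : Series) (row : ℕ → ℕ → ℚ) (beyond : ℕ → ℚ) where

  next : ℕ → ℚ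
  next n = (f (suc n) - sumTo n (λ i → g (suc i) * row n i)) * inv (g 0)

  module _ (row-suc : ∀ n i → row (suc n) (suc i) ≡ (if n ∸ i ≤ᵇ n then row n i else next n))
           (row-diagonal : ∀ n → row n 0 ≡ (f ⊘ g) n) where

    row-stable : ∀ n i → i ≤ n → row n i ≡ (f ⊘ g) (n ∸ i)
    row-stable n       zero    _         = row-diagonal n
    row-stable (suc n) (suc i) (s≤s i≤n) =
      trans (row-suc n i) (trans (if-T (ℕP.≤⇒≤ᵇ (ℕP.m∸n≤m n i))) (row-stable n i i≤n))

    next-unfold : ∀ n → (if n <ᵇ n then beyond n else next n)
                      ≡ (f (suc n) - sumTo n (λ i → g (suc i) * (f ⊘ g) (n ∸ i))) * inv (g 0)
    next-unfold n = trans (if-¬T (λ t → ℕP.n≮n n (ℕP.<ᵇ⇒< n n t)))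
      (cong (λ s → (f (suc n) - s) * inv (g 0))
            (sumTo-cong n (λ i i≤n → cong (g (suc i) *_) (row-stable n i i≤n))))

⊘-suc : ∀ f g n → (f ⊘ g) (suc n) ≡ (f (suc n) - sumTo n (λ i → g (suc i) * (f ⊘ g) (n ∸ i))) * inv (g 0)
⊘-suc f g = QuotientRows.next-unfold f g _ _ (λ _ _ → refl) (λ _ → refl)

⊛-⊘ : ∀ f g → ¬ g 0 ≡ 0ℚ → ∀ N → (g ⊛ (f ⊘ g)) N ≡ f N
⊛-⊘ f g g0≢0 zero = begin
  g 0 * (f 0 * inv (g 0))    ≡⟨ solve 3 (λ c a i → c :* (a :* i) := a :* (c :* i)) refl (g 0) (f 0) (inv (g 0)) ⟩
  f 0 * (g 0 * inv (g 0))    ≡⟨ cong (f 0 *_) (*-invʳ (g 0) g0≢0) ⟩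
  f 0 * 1ℚ                   ≡⟨ ℚP.*-identityʳ (f 0) ⟩
  f 0 ∎
⊛-⊘ f g g0≢0 (suc n) = begin
  sumTo (suc n) (λ i → g i * (f ⊘ g) (suc n ∸ i))
    ≡⟨ sumTo-suc-head n (λ i → g i * (f ⊘ g) (suc n ∸ i)) ⟩
  g 0 * (f ⊘ g) (suc n) +ℚ S
    ≡⟨ cong (λ z → g 0 * z +ℚ S) (⊘-suc f g n) ⟩
  g 0 * ((f (suc n) - S) * inv (g 0)) +ℚ S
    ≡⟨ solve 4 (λ c a b i → c :* ((a :- b) :* i) :+ b := (a :- b) :* (c :* i) :+ b) refl
             (g 0) (f (suc n)) S (inv (g 0)) ⟩
  (f (suc n) - S) * (g 0 * inv (g 0)) +ℚ S
    ≡⟨ cong (λ z → (f (suc n) - S) * z +ℚ S) (*-invʳ (g 0) g0≢0) ⟩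
  (f (suc n) - S) * 1ℚ +ℚ S
    ≡⟨ solve 2 (λ a b → (a :- b) :* con 1ℚ :+ b := a) refl (f (suc n)) S ⟩
  f (suc n) ∎
  where
  S = sumTo n (λ i → g (suc i) * (f ⊘ g) (n ∸ i))

tailExp : ℕ → Series
tailExp m i = if i <ᵇ m then 0ℚ else inv (ℕ→ℚ (i !))

tailExp-vanishes-below : ∀ m → VanishesBelow m (tailExp m)
tailExp-vanishes-below m i i<m = if-T (ℕP.<⇒<ᵇ i<m)

tailExp-+ : ∀ m k → tailExp m (k + m) ≡ inv (ℕ→ℚ ((k + m) !))
tailExp-+ m k = if-¬T (≥⇒¬<ᵇ (ℕP.m≤n+m m k))

denom≡1+tailExp : ∀ m i → denom m i ≡ mono 1ℚ 0 i +ℚ tailExp m i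
denom≡1+tailExp m i =
  trans (cong (λ e → (e +ℚ mono 1ℚ 0 i) - truncExp m i) expS-1)
        (cancel (i <ᵇ m) (inv (ℕ→ℚ (i !))) (mono 1ℚ 0 i))
  where
  expS-1 : expS 1ℚ i ≡ inv (ℕ→ℚ (i !))
  expS-1 = trans (cong (_* inv (ℕ→ℚ (i !))) (1ℚ^ℚn≡1ℚ i)) (ℚP.*-identityˡ (inv (ℕ→ℚ (i !))))
  cancel : ∀ b e d → (e +ℚ d) - (if b then e else 0ℚ) ≡ d +ℚ (if b then 0ℚ else e)
  cancel true  e d = solve 2 (λ e d → (e :+ d) :- e := d :+ con 0ℚ) refl e d
  cancel false e d = solve 2 (λ e d → (e :+ d) :- con 0ℚ := d :+ e) refl e d

denom-0≢0 : ∀ m → ¬ denom m 0 ≡ 0ℚ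
denom-0≢0 zero    ()
denom-0≢0 (suc m) ()

module TruncatedEuler (m : ℕ) (x : ℚ) where

  q : Series
  q = numer m x ⊘ denom m

  q+tailExp⊛q≡numer : ∀ N → q N +ℚ (tailExp m ⊛ q) N ≡ numer m x N
  q+tailExp⊛q≡numer N = begin
    q N +ℚ (tailExp m ⊛ q) N
      ≡⟨ cong (_+ℚ (tailExp m ⊛ q) N) (sym (⊛-identityˡ q N)) ⟩
    (mono 1ℚ 0 ⊛ q) N +ℚ (tailExp m ⊛ q) N
      ≡⟨ sym (⊛-distribʳ-+ (mono 1ℚ 0) (tailExp m) q N) ⟩
    ((λ i → mono 1ℚ 0 i +ℚ tailExp m i) ⊛ q) N
      ≡⟨ sumTo-cong N (λ i _ → cong (_* q (N ∸ i)) (sym (denom≡1+tailExp m i))) ⟩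
    (denom m ⊛ q) N
      ≡⟨ ⊛-⊘ (numer m x) (denom m) (denom-0≢0 m) N ⟩
    numer m x N ∎

  E-below : ∀ n → n < m → E m n x ≡ 0ℚ
  E-below n n<m = trans (cong (ℕ→ℚ (n !) *_) qn≡0) (ℚP.*-zeroʳ (ℕ→ℚ (n !)))
    where
    qn≡0 : q n ≡ 0ℚ
    qn≡0 = begin
      q n                       ≡⟨ sym (ℚP.+-identityʳ (q n)) ⟩
      q n +ℚ 0ℚ                 ≡⟨ cong (q n +ℚ_) (sym tail≡0) ⟩
      q n +ℚ (tailExp m ⊛ q) n  ≡⟨ q+tailExp⊛q≡numer n ⟩
      numer m x n               ≡⟨ numer≡0 ⟩
      0ℚ                        ∎
      where
      tail≡0 = ⊛-vanishes-below (tailExp m) q (tailExp-vanishes-below m) n n<m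
      numer≡0 = ⊛-vanishes-below (mono _ m) (expS x) (λ i i<m → mono-≢ _ m i (ℕP.<⇒≢ i<m)) n n<m

  q-+ : ∀ n → q (n + m) ≡ numer m x (n + m) - (tailExp m ⊛ q) (n + m)
  q-+ n = trans (solve 2 (λ u t → u := (u :+ t) :- t) refl (q (n + m)) ((tailExp m ⊛ q) (n + m)))
                (cong (_- (tailExp m ⊛ q) (n + m)) (q+tailExp⊛q≡numer (n + m)))

  numer-+ : ∀ n → numer m x (n + m) ≡ ℕ→ℚ 2 * inv (ℕ→ℚ (m !)) * expS x n
  numer-+ = mono-⊛ (ℕ→ℚ 2 * inv (ℕ→ℚ (m !))) m (expS x)

  tailExp⊛q-+ : ∀ n → (tailExp m ⊛ q) (n + m) ≡ sumTo n (λ k → inv (ℕ→ℚ ((k + m) !)) * q (n ∸ k))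
  tailExp⊛q-+ n = trans (⊛-shift (tailExp m) q (tailExp-vanishes-below m) n)
                        (sumTo-cong n (λ k _ → cong (_* q (n ∸ k)) (tailExp-+ m k)))

  scaled-numer-+ : ∀ n → ℕ→ℚ ((n + m) !) * (ℕ→ℚ 2 * inv (ℕ→ℚ (m !)) * expS x n)
                       ≡ ℕ→ℚ 2 * ℕ→ℚ ((n + m) C n) * (x ^ℚ n)
  scaled-numer-+ n = begin
    M * (two * inv (ℕ→ℚ (m !)) * (X * inv F))
      ≡⟨ solve 5 (λ M t iB X iF → M :* (t :* iB :* (X :* iF)) := t :* (M :* iB) :* X :* iF) refl
               M two (inv (ℕ→ℚ (m !))) X (inv F) ⟩
    two * (M * inv (ℕ→ℚ (m !))) * X * inv F
      ≡⟨ cong (λ k → two * (M * inv (ℕ→ℚ (k !))) * X * inv F) (sym (ℕP.m+n∸m≡n n m)) ⟩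
    two * (M * inv (ℕ→ℚ (((n + m) ∸ n) !))) * X * inv F
      ≡⟨ cong (λ z → two * z * X * inv F) (n!/[n∸k]!≡nCk*k! (n + m) n (ℕP.m≤m+n n m)) ⟩
    two * (B * F) * X * inv F
      ≡⟨ solve 5 (λ t B F X iF → t :* (B :* F) :* X :* iF := t :* B :* X :* (F :* iF)) refl
               two B F X (inv F) ⟩
    two * B * X * (F * inv F)
      ≡⟨ cong (two * B * X *_) (*-invʳ F (ℕ→ℚ-!≢0 n)) ⟩
    two * B * X * 1ℚ
      ≡⟨ ℚP.*-identityʳ (two * B * X) ⟩
    two * B * X ∎
    where
    M = ℕ→ℚ ((n + m) !)
    two = ℕ→ℚ 2
    B = ℕ→ℚ ((n + m) C n)
    F = ℕ→ℚ (n !)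
    X = x ^ℚ n

  scaled-term : ∀ n j → j ≤ n → ℕ→ℚ ((n + m) !) * (inv (ℕ→ℚ ((n ∸ j + m) !)) * q (n ∸ (n ∸ j)))
                              ≡ ℕ→ℚ ((n + m) C j) * E m j x
  scaled-term n j j≤n = begin
    M * (inv (ℕ→ℚ ((n ∸ j + m) !)) * q (n ∸ (n ∸ j)))
      ≡⟨ cong₂ (λ k i → M * (inv (ℕ→ℚ (k !)) * q i)) (sym (ℕP.+-∸-comm m j≤n)) (ℕP.m∸[m∸n]≡n j≤n) ⟩
    M * (inv (ℕ→ℚ ((n + m ∸ j) !)) * q j)
      ≡⟨ sym (ℚP.*-assoc M _ (q j)) ⟩
    M * inv (ℕ→ℚ ((n + m ∸ j) !)) * q j
      ≡⟨ cong (_* q j) (n!/[n∸k]!≡nCk*k! (n + m) j (ℕP.≤-trans j≤n (ℕP.m≤m+n n m))) ⟩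
    ℕ→ℚ ((n + m) C j) * ℕ→ℚ (j !) * q j
      ≡⟨ ℚP.*-assoc (ℕ→ℚ ((n + m) C j)) (ℕ→ℚ (j !)) (q j) ⟩
    ℕ→ℚ ((n + m) C j) * E m j x ∎
    where
    M = ℕ→ℚ ((n + m) !)

  E-+ : ∀ n → E m (n + m) x ≡ ℕ→ℚ 2 * ℕ→ℚ ((n + m) C n) * (x ^ℚ n)
                               - sumTo n (λ j → ℕ→ℚ ((n + m) C j) * E m j x)
  E-+ n = begin
    M * q (n + m)
      ≡⟨ cong (M *_) (trans (q-+ n) (cong₂ _-_ (numer-+ n) (tailExp⊛q-+ n))) ⟩
    M * (lead - sumTo n termAt)
      ≡⟨ solve 3 (λ M u t → M :* (u :- t) := M :* u :- M :* t) refl M lead (sumTo n termAt) ⟩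
    M * lead - M * sumTo n termAt
      ≡⟨ cong₂ _-_ (scaled-numer-+ n) (trans (*-distribˡ-sumTo n M termAt) (sumTo-reverse n _)) ⟩
    ℕ→ℚ 2 * ℕ→ℚ ((n + m) C n) * (x ^ℚ n) - sumTo n (λ j → M * termAt (n ∸ j))
      ≡⟨ cong (ℕ→ℚ 2 * ℕ→ℚ ((n + m) C n) * (x ^ℚ n) -_) (sumTo-cong n (scaled-term n)) ⟩
    ℕ→ℚ 2 * ℕ→ℚ ((n + m) C n) * (x ^ℚ n) - sumTo n (λ j → ℕ→ℚ ((n + m) C j) * E m j x) ∎
    where
    M = ℕ→ℚ ((n + m) !)
    lead = ℕ→ℚ 2 * inv (ℕ→ℚ (m !)) * expS x n
    termAt : ℕ → ℚ
    termAt k = inv (ℕ→ℚ ((k + m) !)) * q (n ∸ k)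

mainTheorem2 : (m : ℕ) (x : ℚ) →
    ((n : ℕ) → n < m → E m n x ≡ 0ℚ) ×
    ((n : ℕ) → E m (n + m) x ≡
      (ℕ→ℚ 2 *ℚ ℕ→ℚ ((n + m) C n) *ℚ (x ^ℚ n))
        -ℚ sumTo n (λ j → ℕ→ℚ ((n + m) C j) *ℚ E m j x))
mainTheorem2 m x = E-below , E-+
  where open TruncatedEuler m x
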